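{- Let $n\ge1$ and $R_i$ ($-n-1\le i\le n+1$) be as in the context. For each $i\in\{ -n-1,\dots,n+1\}$, $R_i$ is an upset of $\langle X^2,\preceq\rangle$, where $(u,v)\preceq(x,y)$ iff $x\le_X u$ and $v\le_X y$.
   Context: For $p=(p_1,\dots,p_n)\in\mathbb Q^n$: $(p,q)\in L_1$ iff $p_1<q_1$; for $2\le i\le n$, $(p,q)\in L_i$ iff $(p_1,\dots,p_{i-1})=(q_1,\dots,q_{i-1})$ and $p_i<q_i$. Let $<_n=L_1\cup\dots\cup L_n$. $X=\mathbb Q^n\times\{ -1,1\}$, writing $p^b$ for $(p,b)$, with $p^b\le_X q^d$ iff $p^b=q^d$ or $p<_nq$; $\alpha(p^b)=p^{ -b}$. For $R\subseteq X^2$, $R^c=X^2\setminus R$, $R^\smile$ the converse, $\circ$ relational composition. $U_j=\{(p^b,q^d)\mid b,d\in\{ -1,1\},(p,q)\in L_j\}$. $R_{ -n-1}=\varnothing$; $R_i=\bigcup_{j=1}^{n+1+i}U_j$ for $-n\le i\le-1$; $R_0={\le_X}$; $R_i=(R_{ -i})^{c\smile}\circ\alpha$ for $1\le i\le n+1$. -}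

module Defs where

open import Data.Nat using (ℕ; zero; suc; _∸_)
import Data.Nat as ℕ
open import Data.Integer using (ℤ; +_; -[1+_])
open import Data.Rational using (ℚ; _<_)
open import Data.Fin using (Fin; toℕ)
open import Data.Vec using (Vec; lookup)
open import Data.Product using (Σ; _×_; _,_)
open import Data.Sum using (_⊎_)
open import Data.Empty using (⊥)
open import Relation.Nullary using (¬_)
open import Relation.Binary.PropositionalEquality using (_≡_)

-- Points of ℚⁿ; coordinate index k : Fin n stands for the paper's index k+1.
Pt : ℕ → Set
Pt n = Vec ℚ n

L : ∀ {n} → Fin n → Pt n → Pt n → Set
L {n} k p q = ((m : Fin n) → toℕ m ℕ.< toℕ k → lookup p m ≡ lookup q m) × (lookup p k < lookup q k)

_<ₙ_ : ∀ {n} → Pt n → Pt n → Set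
_<ₙ_ {n} p q = Σ (Fin n) λ k → L k p q

data Sgn : Set where
  minus plus : Sgn

neg : Sgn → Sgn
neg minus = plus
neg plus = minus

X : ℕ → Set
X n = Pt n × Sgn

Rel : ℕ → Set₁
Rel n = X n → X n → Set

_≤X_ : ∀ {n} → Rel n
x ≤X y = x ≡ y ⊎ (Data.Product.proj₁ x <ₙ Data.Product.proj₁ y)

α : ∀ {n} → X n → X n
α (p , b) = (p , neg b)

U : ∀ {n} → Fin n → Rel n
U k (p , b) (q , d) = L k p q

-- ⋃_{j=1}^{k} U_j  (Fin index j < k)
Ubig : ∀ {n} → ℕ → Rel n
Ubig {n} k x y = Σ (Fin n) λ j → (toℕ j ℕ.< k) × U j x y

_ᶜ : ∀ {n} → Rel n → Rel n
(S ᶜ) x y = ¬ S x y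

_˘ : ∀ {n} → Rel n → Rel n
(S ˘) x y = S y x

_⨾_ : ∀ {n} → Rel n → Rel n → Rel n
(S ⨾ T) x z = Σ _ λ y → S x y × T y z

αRel : ∀ {n} → Rel n
αRel x y = α x ≡ y

-- R_i for negative i:  R_{-(m+1)} = ⋃_{j=1}^{n-m} U_j  (for m = n this is ∅ = R_{-n-1})
Rneg : (n m : ℕ) → Rel n
Rneg n m = Ubig (n ∸ m)

R : (n : ℕ) → ℤ → Rel n
R n (+ zero) = _≤X_
R n (+ suc m) = ((Rneg n m) ᶜ ˘) ⨾ αRel
R n -[1+ m ] = Rneg n m

_⪯_ : ∀ {n} → X n × X n → X n × X n → Set
(u , v) ⪯ (x , y) = (x ≤X u) × (v ≤X y)

IsUpset : ∀ {n} → Rel n → Set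
IsUpset S = ∀ u v x y → S u v → (u , v) ⪯ (x , y) → S x y

{-# OPTIONS --safe #-}
module Submission where

-- Composing an L_a-step with an L_b-step gives an L_c-step with c ≤ a, b, so
-- ⋃_{j<k} U_j absorbs ≤X on either side and is therefore an upset; ≤X is one by
-- transitivity.  Since α is an automorphism of ≤X, the operation S ↦ (Sᶜ)˘ ⨾ α
-- preserves upsets, which covers the positive indices.

open import Defs
open import Data.Nat using (ℕ; suc)
import Data.Nat as ℕ
import Data.Nat.Properties as ℕ
open import Data.Integer using (ℤ; +_; -[1+_]; _≤_)
open import Data.Fin using (Fin; toℕ)
open import Data.Fin.Properties using (toℕ-injective)
open import Data.Vec using (lookup)
import Data.Rational as ℚ using (_<_)
import Data.Rational.Properties as ℚ
open import Data.Product using (Σ; _×_; _,_; proj₁)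
open import Data.Sum using (inj₁; inj₂)
open import Relation.Binary.PropositionalEquality
open import Relation.Nullary using (¬_)
open import Relation.Binary.Definitions using (tri<; tri≈; tri>)

L-trans : ∀ {n} {a b : Fin n} (p q r : Pt n) → L a p q → L b q r →
          Σ (Fin n) λ c → (toℕ c ℕ.≤ toℕ a) × (toℕ c ℕ.≤ toℕ b) × L c p r
L-trans {a = a} {b} p q r (p≈q , pa<qa) (q≈r , qb<rb) with ℕ.<-cmp (toℕ a) (toℕ b)
... | tri< a<b _ _ =
  a , ℕ.≤-refl , ℕ.<⇒≤ a<b ,
  (λ m m<a → trans (p≈q m m<a) (q≈r m (ℕ.<-trans m<a a<b))) ,
  subst (lookup p a ℚ.<_) (q≈r a a<b) pa<qa
... | tri> _ _ b<a =
  b , ℕ.<⇒≤ b<a , ℕ.≤-refl ,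
  (λ m m<b → trans (p≈q m (ℕ.<-trans m<b b<a)) (q≈r m m<b)) ,
  subst (ℚ._< lookup r b) (sym (p≈q b b<a)) qb<rb
... | tri≈ _ a≡b _ with toℕ-injective a≡b
... | refl =
  a , ℕ.≤-refl , ℕ.≤-refl ,
  (λ m m<a → trans (p≈q m m<a) (q≈r m m<a)) ,
  ℚ.<-trans pa<qa qb<rb

<ₙ-trans : ∀ {n} (p q r : Pt n) → p <ₙ q → q <ₙ r → p <ₙ r
<ₙ-trans p q r (_ , pLq) (_ , qLr) with L-trans p q r pLq qLr
... | c , _ , _ , pLr = c , pLr

≤X-trans : ∀ {n} {x y z : X n} → x ≤X y → y ≤X z → x ≤X z
≤X-trans (inj₁ refl) y≤z         = y≤z
≤X-trans (inj₂ x<y)  (inj₁ refl) = inj₂ x<y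
≤X-trans {x = x} {y} {z} (inj₂ x<y) (inj₂ y<z) =
  inj₂ (<ₙ-trans (proj₁ x) (proj₁ y) (proj₁ z) x<y y<z)

≤X-Ubig-trans : ∀ {n} k {x y z : X n} → x ≤X y → Ubig k y z → Ubig k x z
≤X-Ubig-trans k (inj₁ refl) yUz = yUz
≤X-Ubig-trans k {x} {y} {z} (inj₂ (_ , xLy)) (j , j<k , yLz)
  with L-trans (proj₁ x) (proj₁ y) (proj₁ z) xLy yLz
... | c , _ , c≤j , xLz = c , ℕ.≤-<-trans c≤j j<k , xLz

Ubig-≤X-trans : ∀ {n} k {x y z : X n} → Ubig k x y → y ≤X z → Ubig k x z
Ubig-≤X-trans k xUy (inj₁ refl) = xUy
Ubig-≤X-trans k {x} {y} {z} (j , j<k , xLy) (inj₂ (_ , yLz))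
  with L-trans (proj₁ x) (proj₁ y) (proj₁ z) xLy yLz
... | c , c≤j , _ , xLz = c , ℕ.≤-<-trans c≤j j<k , xLz

≤X-upset : ∀ {n} → IsUpset (_≤X_ {n})
≤X-upset u v x y u≤v (x≤u , v≤y) = ≤X-trans x≤u (≤X-trans u≤v v≤y)

Ubig-upset : ∀ {n} k → IsUpset (Ubig {n} k)
Ubig-upset k u v x y uUv (x≤u , v≤y) =
  Ubig-≤X-trans k {x} {v} {y} (≤X-Ubig-trans k {x} {u} {v} x≤u uUv) v≤y

α-involutive : ∀ {n} (x : X n) → α (α x) ≡ x
α-involutive (p , minus) = refl
α-involutive (p , plus)  = refl

α-≤X-swap : ∀ {n} {x y : X n} → α x ≤X y → x ≤X α y
α-≤X-swap {x = x} (inj₁ refl) = inj₁ (sym (α-involutive x))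
α-≤X-swap         (inj₂ x<y)  = inj₂ x<y

ᶜ˘⨾α-upset : ∀ {n} {S : Rel n} → IsUpset S → IsUpset ((S ᶜ ˘) ⨾ αRel)
ᶜ˘⨾α-upset {S = S} S-up u v x y (w , ¬Swu , refl) (x≤u , αw≤y) =
  α y , ¬Sαyx , α-involutive y
  where
  ¬Sαyx : ¬ S (α y) x
  ¬Sαyx Sαyx = ¬Swu (S-up (α y) x w u Sαyx (α-≤X-swap αw≤y , x≤u))

R-upset : ∀ n i → IsUpset (R n i)
R-upset n (+ ℕ.zero) = ≤X-upset
R-upset n (+ suc m)  = ᶜ˘⨾α-upset (Ubig-upset (n ℕ.∸ m))
R-upset n -[1+ m ]   = Ubig-upset (n ℕ.∸ m)

lemma3p3 : (n : ℕ) → 1 ℕ.≤ n → (i : ℤ) → -[1+ n ] ≤ i → i ≤ + suc n → IsUpset (R n i)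
lemma3p3 n _ i _ _ = R-upset n i
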